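{- For every $n\ge 1$, $R_n^{(1,\emptyset,0,0)}(x)=(x+1)(x+2)\cdots(x+n-1)$ (an empty product being $1$), and \[ R^{(1,\emptyset,0,0)}(t,x)=1+\frac{(1-t)^{ -x}-1}{x}. \]
   Context: For $\sigma=\sigma_1\cdots\sigma_n\in S_n$ and an index $i$: quadrant I relative to $(i,\sigma_i)$ consists of the points $(j,\sigma_j)$ with $j>i,\sigma_j>\sigma_i$, and quadrant II of those with $j<i,\sigma_j>\sigma_i$. $\sigma_i$ matches $MMP(1,\emptyset,0,0)$ if quadrant I contains at least one point and quadrant II contains no point. $mmp^{(1,\emptyset,0,0)}(\sigma)$ is the number of such $i$, $R_n^{(1,\emptyset,0,0)}(x)=\sum_{\sigma\in S_n}x^{mmp^{(1,\emptyset,0,0)}(\sigma)}$, and $R^{(1,\emptyset,0,0)}(t,x)=1+\sum_{n\ge1}R_n^{(1,\emptyset,0,0)}(x)\frac{t^n}{n!}$. -}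

module Defs where

open import Data.Nat using (ℕ; zero; suc; _+_; _*_; _<ᵇ_; _≡ᵇ_)
open import Data.Bool using (Bool; true; false; _∧_; not; if_then_else_)
open import Data.Fin using (Fin; toℕ)
open import Data.Bool.ListAction using (any)
open import Data.List using (List; []; _∷_; map; concatMap; filter; length; allFin)
open import Data.Vec using (Vec; toList) renaming ([] to []ᵥ; _∷_ to _∷ᵥ_)
open import Data.Integer as ℤ using (ℤ)

-- A word σ = σ₁⋯σₙ is a vector of length n with entries in Fin n
-- (values 0..n-1 stand for 1..n; only relative order matters).
-- σ ∈ S_n iff its entries are pairwise distinct.

allWords : (n m : ℕ) → List (Vec (Fin n) m)
allWords n zero    = []ᵥ ∷ []
allWords n (suc m) = concatMap (λ a → map (a ∷ᵥ_) (allWords n m)) (allFin n)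

allDistinct : List ℕ → Bool
allDistinct []       = true
allDistinct (a ∷ xs) = not (any (λ b → a ≡ᵇ b) xs) ∧ allDistinct xs

values : {n : ℕ} → Vec (Fin n) n → List ℕ
values σ = map toℕ (toList σ)

isPerm : {n : ℕ} → Vec (Fin n) n → Bool
isPerm σ = allDistinct (values σ)

perms : (n : ℕ) → List (Vec (Fin n) n)
perms n = filter (λ σ → Data.Bool._≟_ (isPerm σ) true) (allWords n n)
  where import Data.Bool

-- mmp^{(1,∅,0,0)}: number of positions i such that some j > i has
-- σ_j > σ_i (quadrant I nonempty) and no j < i has σ_j > σ_i
-- (quadrant II empty).  `pre` holds the entries left of the current one.

mmpAux : List ℕ → List ℕ → ℕ
mmpAux pre []         = 0
mmpAux pre (a ∷ rest) =
  (if any (λ b → a <ᵇ b) rest ∧ not (any (λ b → a <ᵇ b) pre) then 1 else 0)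
  + mmpAux (a ∷ pre) rest

mmp : {n : ℕ} → Vec (Fin n) n → ℕ
mmp σ = mmpAux [] (values σ)

-- coefficient of x^k in R_n(x) = Σ_{σ ∈ S_n} x^{mmp σ}
Rcoeff : ℕ → ℕ → ℕ
Rcoeff n k = length (filter (λ σ → Data.Nat._≟_ (mmp σ) k) (perms n))
  where import Data.Nat

-- Polynomials in x as coefficient functions (coefficient of x^k).

one : ℕ → ℕ
one zero    = 1
one (suc _) = 0

mulXplus : ℕ → (ℕ → ℕ) → (ℕ → ℕ)
mulXplus i p zero    = i * p zero
mulXplus i p (suc k) = p k + i * p (suc k)

-- prodP m = (x+1)(x+2)⋯(x+m)   (prodP 0 = 1, the empty product)
prodP : ℕ → (ℕ → ℕ)
prodP zero    = one
prodP (suc m) = mulXplus (suc m) (prodP m)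

-- Bivariate series in ℤ[x][[t]], exponential in t:
-- S n k = coefficient of x^k in the coefficient of t^n/n!.

Series : Set
Series = ℕ → ℕ → ℤ

oneℤ : ℕ → ℤ
oneℤ zero    = ℤ.+ 1
oneℤ (suc _) = ℤ.+ 0

zeroℤ : ℕ → ℤ
zeroℤ _ = ℤ.+ 0

oneS : Series
oneS zero    = oneℤ
oneS (suc _) = zeroℤ

_⊕_ : Series → Series → Series
(A ⊕ B) n k = A n k ℤ.+ B n k

_⊖_ : Series → Series → Series
(A ⊖ B) n k = A n k ℤ.- B n k

-- division by x (exact when every constant-in-x coefficient vanishes)
divX : Series → Series
divX A n k = A n (suc k)

mulXplusℤ : ℕ → (ℕ → ℤ) → (ℕ → ℤ)
mulXplusℤ i p zero    = ℤ.+ i ℤ.* p zero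
mulXplusℤ i p (suc k) = p k ℤ.+ ℤ.+ i ℤ.* p (suc k)

rising : ℕ → (ℕ → ℤ)
rising zero    = oneℤ
rising (suc m) = mulXplusℤ m (rising m)

-- (1 - t)^{-x} = Σ_n binom(-x,n) (-t)^n = Σ_n x(x+1)⋯(x+n-1) t^n/n!
binomSeries : Series
binomSeries n = rising n

-- R^{(1,∅,0,0)}(t,x) = 1 + Σ_{n≥1} R_n(x) t^n/n!
Rseries : Series
Rseries zero    = oneℤ
Rseries (suc m) k = ℤ.+ Rcoeff (suc m) k

-- An entry counted by mmp is a left-to-right maximum (a record) with a larger entry to its right,
-- i.e. any record but the overall maximum; so on permutations mmp = records - 1, and R_n(x) is
-- x(x + 1) ⋯ (x + n - 1) / x. The records distribution is computed by reading the word from the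
-- left: given the entries read so far, it depends only on the number m of values still available
-- and the number r of those exceeding everything read, and its generating polynomial is
-- (m! / r!) · x(x + 1) ⋯ (x + r - 1). This follows by induction on m: a non-record first letter
-- keeps r, while the r possible record first letters leave 0, 1, …, r - 1 values above them,
-- each contributing a factor x. For m = r = n this is x(x + 1) ⋯ (x + n - 1), the coefficient
-- of tⁿ/n! in (1 - t)^(-x).
module Submission where

open import Defs
open import Algebra.Bundles using (CommutativeMonoid)
open import Data.Bool using (Bool; true; false; _∧_; _∨_; not; if_then_else_; T)
import Data.Bool as Bool
open import Data.Bool.ListAction using (any; all)
open import Data.Bool.Properties
  using (T-≡; ¬-not; ∧-zeroʳ; ∧-identityʳ; ∨-identityʳ; ∨-zeroʳ; ∧-commutativeMonoid)
open import Data.Empty using (⊥-elim)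
open import Data.Fin using (Fin; toℕ) renaming (zero to fzero; suc to fsuc)
open import Data.List using (List; []; _∷_; map; concatMap; filter; length; tabulate; allFin; _++_)
open import Data.Nat using (ℕ; zero; suc; _+_; _*_; _∸_; _≤_; _<_; _≡ᵇ_; _<ᵇ_; _⊔_; z≤n; s≤s)
open import Data.Nat.Properties
open import Data.Nat.Tactic.RingSolver using (solve-∀)
open import Data.Sum using (inj₁; inj₂)
open import Data.Vec using (Vec; toList) renaming (_∷_ to _∷ᵥ_)
open import Function using (_∘_)
open import Function.Bundles using (Equivalence)
open import Relation.Binary using (tri<; tri≈; tri>)
open import Relation.Binary.PropositionalEquality
open import Relation.Nullary using (does; yes; no; contradiction)
open import Relation.Unary using (Decidable)
open import Algebra.Properties.CommutativeSemigroup +-commutativeSemigroup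
  using () renaming (interchange to +-interchange)
open import Algebra.Properties.CommutativeSemigroup
  (CommutativeMonoid.commutativeSemigroup ∧-commutativeMonoid) using (x∙yz≈y∙xz; xy∙z≈y∙xz)

private variable
  A B : Set

boolToℕ : Bool → ℕ
boolToℕ b = if b then 1 else 0

sumOver : (A → ℕ) → List A → ℕ
sumOver f []       = 0
sumOver f (x ∷ xs) = f x + sumOver f xs

count : (A → Bool) → List A → ℕ
count p = sumOver (boolToℕ ∘ p)

range : ℕ → ℕ → List ℕ
range c zero    = []
range c (suc d) = c ∷ range (suc c) d

sumOver-cong : ∀ {f g : A → ℕ} → (∀ x → f x ≡ g x) → ∀ xs → sumOver f xs ≡ sumOver g xs
sumOver-cong f≗g []       = refl
sumOver-cong f≗g (x ∷ xs) = cong₂ _+_ (f≗g x) (sumOver-cong f≗g xs)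

sumOver-zero : ∀ {f : A → ℕ} → (∀ x → f x ≡ 0) → ∀ xs → sumOver f xs ≡ 0
sumOver-zero f≗0 []       = refl
sumOver-zero f≗0 (x ∷ xs) = cong₂ _+_ (f≗0 x) (sumOver-zero f≗0 xs)

sumOver-+ : ∀ (f g : A → ℕ) xs → sumOver (λ x → f x + g x) xs ≡ sumOver f xs + sumOver g xs
sumOver-+ f g []       = refl
sumOver-+ f g (x ∷ xs) = trans (cong (f x + g x +_) (sumOver-+ f g xs))
                               (+-interchange (f x) (g x) (sumOver f xs) (sumOver g xs))

sumOver-*ʳ : ∀ (f : A → ℕ) v xs → sumOver (λ x → f x * v) xs ≡ sumOver f xs * v
sumOver-*ʳ f v []       = refl
sumOver-*ʳ f v (x ∷ xs) = trans (cong (f x * v +_) (sumOver-*ʳ f v xs))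
                                (sym (*-distribʳ-+ v (f x) (sumOver f xs)))

sumOver-++ : ∀ (f : A → ℕ) xs ys → sumOver f (xs ++ ys) ≡ sumOver f xs + sumOver f ys
sumOver-++ f []       ys = refl
sumOver-++ f (x ∷ xs) ys = trans (cong (f x +_) (sumOver-++ f xs ys))
                                 (sym (+-assoc (f x) (sumOver f xs) (sumOver f ys)))

sumOver-concatMap : ∀ (f : B → ℕ) (g : A → List B) xs →
                    sumOver f (concatMap g xs) ≡ sumOver (sumOver f ∘ g) xs
sumOver-concatMap f g []       = refl
sumOver-concatMap f g (x ∷ xs) = trans (sumOver-++ f (g x) (concatMap g xs))
                                       (cong (sumOver f (g x) +_) (sumOver-concatMap f g xs))

sumOver-map : ∀ (f : B → ℕ) (g : A → B) xs → sumOver f (map g xs) ≡ sumOver (f ∘ g) xs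
sumOver-map f g []       = refl
sumOver-map f g (x ∷ xs) = cong (f (g x) +_) (sumOver-map f g xs)

count-split : ∀ (p q : A → Bool) xs →
              count (λ x → p x ∧ not (q x)) xs + count (λ x → p x ∧ q x) xs ≡ count p xs
count-split p q []       = refl
count-split p q (x ∷ xs) with p x | q x
... | false | _     = count-split p q xs
... | true  | true  = trans (+-suc _ _) (cong suc (count-split p q xs))
... | true  | false = cong suc (count-split p q xs)

length-filter : ∀ {P : A → Set} (P? : Decidable P) xs → length (filter P? xs) ≡ count (does ∘ P?) xs
length-filter P? []       = refl
length-filter P? (x ∷ xs) with does (P? x)
... | true  = cong suc (length-filter P? xs)
... | false = length-filter P? xs

count-filter : ∀ {P : A → Set} (P? : Decidable P) (p : A → Bool) xs →
               count p (filter P? xs) ≡ count (λ x → does (P? x) ∧ p x) xs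
count-filter P? p []       = refl
count-filter P? p (x ∷ xs) with does (P? x)
... | true  = cong (boolToℕ (p x) +_) (count-filter P? p xs)
... | false = count-filter P? p xs

sumOver-tabulate : ∀ n (t : Fin n → A) (f : A → ℕ) (F : ℕ → ℕ) c →
                   (∀ i → f (t i) ≡ F (c + toℕ i)) → sumOver f (tabulate t) ≡ sumOver F (range c n)
sumOver-tabulate zero    t f F c eq = refl
sumOver-tabulate (suc n) t f F c eq =
  cong₂ _+_ (trans (eq fzero) (cong F (+-identityʳ c)))
            (sumOver-tabulate n (t ∘ fsuc) f F (suc c) (λ i → trans (eq (fsuc i)) (cong F (+-suc c (toℕ i)))))

sumOver-range-cong : ∀ {f g : ℕ → ℕ} c d → (∀ a → c ≤ a → a < c + d → f a ≡ g a) →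
                     sumOver f (range c d) ≡ sumOver g (range c d)
sumOver-range-cong c zero    f≗g = refl
sumOver-range-cong c (suc d) f≗g =
  cong₂ _+_ (f≗g c ≤-refl (subst (c <_) (sym (+-suc c d)) (s≤s (m≤m+n c d))))
            (sumOver-range-cong (suc c) d (λ a c<a a<c+d →
               f≗g a (<⇒≤ c<a) (subst (a <_) (sym (+-suc c d)) a<c+d)))

count-range-true : ∀ c d → count (λ _ → true) (range c d) ≡ d
count-range-true c zero    = refl
count-range-true c (suc d) = cong suc (count-range-true (suc c) d)

<⇒<ᵇ≡true : ∀ {a b} → a < b → (a <ᵇ b) ≡ true
<⇒<ᵇ≡true a<b = Equivalence.to T-≡ (<⇒<ᵇ a<b)

≤⇒<ᵇ≡false : ∀ {a b} → b ≤ a → (a <ᵇ b) ≡ false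
≤⇒<ᵇ≡false {a} {b} b≤a = ¬-not (λ a<ᵇb → ≤⇒≯ b≤a (<ᵇ⇒< a b (Equivalence.from T-≡ a<ᵇb)))

<ᵇ≡true⇒< : ∀ a b → (a <ᵇ b) ≡ true → a < b
<ᵇ≡true⇒< a b a<ᵇb = <ᵇ⇒< a b (Equivalence.from T-≡ a<ᵇb)

<ᵇ≡false⇒≥ : ∀ a b → (a <ᵇ b) ≡ false → b ≤ a
<ᵇ≡false⇒≥ a b a≮ᵇb = ≮⇒≥ (λ a<b → subst T a≮ᵇb (<⇒<ᵇ a<b))

≡ᵇ-refl : ∀ a → (a ≡ᵇ a) ≡ true
≡ᵇ-refl a = Equivalence.to T-≡ (≡⇒≡ᵇ a a refl)

≡ᵇ≡true⇒≡ : ∀ a b → (a ≡ᵇ b) ≡ true → a ≡ b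
≡ᵇ≡true⇒≡ a b a≡ᵇb = ≡ᵇ⇒≡ a b (Equivalence.from T-≡ a≡ᵇb)

≢⇒≡ᵇ≡false : ∀ {a b} → a ≢ b → (a ≡ᵇ b) ≡ false
≢⇒≡ᵇ≡false {a} {b} a≢b = ¬-not (λ a≡ᵇb → a≢b (≡ᵇ≡true⇒≡ a b a≡ᵇb))

≡ᵇ-sym : ∀ a b → (a ≡ᵇ b) ≡ (b ≡ᵇ a)
≡ᵇ-sym zero    zero    = refl
≡ᵇ-sym zero    (suc b) = refl
≡ᵇ-sym (suc a) zero    = refl
≡ᵇ-sym (suc a) (suc b) = ≡ᵇ-sym a b

count-range-≡ᵇ : ∀ a c d → c ≤ a → a < c + d → count (_≡ᵇ a) (range c d) ≡ 1
count-range-≡ᵇ a c zero    c≤a a<c = ⊥-elim (<⇒≱ (subst (a <_) (+-identityʳ c) a<c) c≤a)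
count-range-≡ᵇ a c (suc d) c≤a a<c+d with c ≟ a
... | yes refl = cong₂ _+_ (cong boolToℕ (≡ᵇ-refl c))
  (trans (sumOver-range-cong (suc c) d (λ b c<b _ → cong boolToℕ (≢⇒≡ᵇ≡false (>⇒≢ c<b))))
         (sumOver-zero (λ _ → refl) (range (suc c) d)))
... | no c≢a = trans (cong (λ e → boolToℕ e + count (_≡ᵇ a) (range (suc c) d)) (≢⇒≡ᵇ≡false c≢a))
                     (count-range-≡ᵇ a (suc c) d (≤∧≢⇒< c≤a c≢a) (subst (a <_) (+-suc c d) a<c+d))

sumBelow : (ℕ → ℕ) → ℕ → ℕ
sumBelow F zero    = 0
sumBelow F (suc r) = F r + sumBelow F r

sumOver-countAbove : ∀ (U : ℕ → Bool) (F : ℕ → ℕ) c d →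
  sumOver (λ a → boolToℕ (U a) * F (count (λ b → (a <ᵇ b) ∧ U b) (range c d))) (range c d)
    ≡ sumBelow F (count U (range c d))
sumOver-countAbove U F c zero    = refl
sumOver-countAbove U F c (suc d) = begin
  boolToℕ (U c) * F (countAbove c (c ∷ R)) + sumOver (λ a → boolToℕ (U a) * F (countAbove a (c ∷ R))) R
    ≡⟨ cong₂ _+_ (cong (λ j → boolToℕ (U c) * F j) head-rank) tail-sum ⟩
  boolToℕ (U c) * F (count U R) + sumBelow F (count U R)
    ≡⟨ sumBelow-cons (U c) ⟩
  sumBelow F (boolToℕ (U c) + count U R) ∎
  where
  open ≡-Reasoning
  R = range (suc c) d
  countAbove : ℕ → List ℕ → ℕ
  countAbove a = count (λ b → (a <ᵇ b) ∧ U b)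
  head-rank : countAbove c (c ∷ R) ≡ count U R
  head-rank = cong₂ _+_ (cong (λ e → boolToℕ (e ∧ U c)) (≤⇒<ᵇ≡false (≤-refl {c})))
    (sumOver-range-cong (suc c) d (λ b c<b _ → cong (λ e → boolToℕ (e ∧ U b)) (<⇒<ᵇ≡true c<b)))
  tail-sum : sumOver (λ a → boolToℕ (U a) * F (countAbove a (c ∷ R))) R ≡ sumBelow F (count U R)
  tail-sum = trans (sumOver-range-cong (suc c) d (λ a c<a _ →
      cong (λ e → boolToℕ (U a) * F (boolToℕ (e ∧ U c) + countAbove a R)) (≤⇒<ᵇ≡false (<⇒≤ c<a))))
    (sumOver-countAbove U F (suc c) d)
  sumBelow-cons : ∀ u →
    boolToℕ u * F (count U R) + sumBelow F (count U R) ≡ sumBelow F (boolToℕ u + count U R)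
  sumBelow-cons true  = cong (_+ sumBelow F (count U R)) (*-identityˡ (F (count U R)))
  sumBelow-cons false = refl

infixl 7 _·_

_·_ : ℕ → (ℕ → ℕ) → ℕ → ℕ
(c · p) k = c * p k

mulX : (ℕ → ℕ) → ℕ → ℕ
mulX p zero    = 0
mulX p (suc k) = p k

mulXplus≗mulX+· : ∀ i p k → mulXplus i p k ≡ mulX p k + (i · p) k
mulXplus≗mulX+· i p zero    = refl
mulXplus≗mulX+· i p (suc k) = refl

mulXplus-cong : ∀ i {p q} → p ≗ q → mulXplus i p ≗ mulXplus i q
mulXplus-cong i p≗q zero    = cong (i *_) (p≗q zero)
mulXplus-cong i p≗q (suc k) = cong₂ (λ a b → a + i * b) (p≗q k) (p≗q (suc k))

mulX-cong : ∀ {p q} → p ≗ q → mulX p ≗ mulX q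
mulX-cong p≗q zero    = refl
mulX-cong p≗q (suc k) = p≗q k

mulX-+ : ∀ p q k → mulX (λ j → p j + q j) k ≡ mulX p k + mulX q k
mulX-+ p q zero    = refl
mulX-+ p q (suc k) = refl

mulXplus-· : ∀ i c p → mulXplus i (c · p) ≗ c · mulXplus i p
mulXplus-· i c p zero    = lemma i c (p zero)
  where lemma : ∀ i c x → i * (c * x) ≡ c * (i * x)
        lemma = solve-∀
mulXplus-· i c p (suc k) = lemma i c (p k) (p (suc k))
  where lemma : ∀ i c x y → c * x + i * (c * y) ≡ c * (x + i * y)
        lemma = solve-∀

risingℕ : ℕ → ℕ → ℕ
risingℕ zero    = one
risingℕ (suc r) = mulXplus r (risingℕ r)

ascending : ℕ → ℕ → ℕ
ascending r zero    = 1
ascending r (suc d) = (r + suc d) * ascending r d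

ascending-suc : ∀ r d → ascending r (suc d) ≡ suc r * ascending (suc r) d
ascending-suc r zero    = cong (_* 1) (+-comm r 1)
ascending-suc r (suc d) = begin
  (r + suc (suc d)) * ascending r (suc d)         ≡⟨ cong ((r + suc (suc d)) *_) (ascending-suc r d) ⟩
  (r + suc (suc d)) * (suc r * ascending (suc r) d) ≡⟨ lemma r d (ascending (suc r) d) ⟩
  suc r * ((suc r + suc d) * ascending (suc r) d)   ∎
  where
  open ≡-Reasoning
  lemma : ∀ r d x → (r + suc (suc d)) * (suc r * x) ≡ suc r * ((suc r + suc d) * x)
  lemma = solve-∀

-- For r ≤ m, (m! / r!) · x(x + 1) ⋯ (x + r - 1): the records polynomial of the arrangements of
-- m available values, r of which exceed every value already read.
arrangementPoly : ℕ → ℕ → ℕ → ℕ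
arrangementPoly m r = ascending r (m ∸ r) · risingℕ r

mulX-sumBelow-arrangementPoly : ∀ {m r} → r ≤ m →
  mulX (λ k → sumBelow (λ j → arrangementPoly m j k) r) ≗ r · arrangementPoly m r
mulX-sumBelow-arrangementPoly {r = zero} _ zero    = refl
mulX-sumBelow-arrangementPoly {r = zero} _ (suc k) = refl
mulX-sumBelow-arrangementPoly {m} {suc r} r<m k = begin
  mulX (λ k → arrangementPoly m r k + S k) k
    ≡⟨ mulX-+ (arrangementPoly m r) S k ⟩
  mulX (arrangementPoly m r) k + mulX S k
    ≡⟨ cong (mulX (arrangementPoly m r) k +_) (mulX-sumBelow-arrangementPoly (<⇒≤ r<m) k) ⟩
  mulX (arrangementPoly m r) k + r * arrangementPoly m r k
    ≡⟨ mulXplus≗mulX+· r (arrangementPoly m r) k ⟨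
  mulXplus r (ascending r (m ∸ r) · risingℕ r) k
    ≡⟨ mulXplus-· r (ascending r (m ∸ r)) (risingℕ r) k ⟩
  ascending r (m ∸ r) * risingℕ (suc r) k
    ≡⟨ cong (_* risingℕ (suc r) k) ascending-step ⟩
  suc r * ascending (suc r) (m ∸ suc r) * risingℕ (suc r) k
    ≡⟨ *-assoc (suc r) (ascending (suc r) (m ∸ suc r)) (risingℕ (suc r) k) ⟩
  suc r * arrangementPoly m (suc r) k ∎
  where
  open ≡-Reasoning
  S = λ k → sumBelow (λ j → arrangementPoly m j k) r
  ascending-step : ascending r (m ∸ r) ≡ suc r * ascending (suc r) (m ∸ suc r)
  ascending-step = trans (cong (ascending r) (+-∸-assoc 1 r<m)) (ascending-suc r (m ∸ suc r))

arrangementPoly-suc : ∀ {m r} → r ≤ m → arrangementPoly (suc m) r ≗ suc m · arrangementPoly m r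
arrangementPoly-suc {m} {r} r≤m k = begin
  ascending r (suc m ∸ r) * risingℕ r k
    ≡⟨ cong (λ d → ascending r d * risingℕ r k) (+-∸-assoc 1 r≤m) ⟩
  (r + suc (m ∸ r)) * ascending r (m ∸ r) * risingℕ r k
    ≡⟨ cong (λ a → a * ascending r (m ∸ r) * risingℕ r k) (trans (+-suc r (m ∸ r)) (cong suc (m+[n∸m]≡n r≤m))) ⟩
  suc m * ascending r (m ∸ r) * risingℕ r k
    ≡⟨ *-assoc (suc m) (ascending r (m ∸ r)) (risingℕ r k) ⟩
  suc m * arrangementPoly m r k ∎
  where open ≡-Reasoning

arrangementPoly-diag : ∀ m → arrangementPoly m m ≗ risingℕ m
arrangementPoly-diag m k =
  trans (cong (λ d → ascending m d * risingℕ m k) (n∸n≡0 m)) (+-identityʳ (risingℕ m k))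

mulX-sumBelow-arrangementPoly-top : ∀ m →
  mulX (λ k → sumBelow (λ j → arrangementPoly m j k) (suc m)) ≗ arrangementPoly (suc m) (suc m)
mulX-sumBelow-arrangementPoly-top m k = begin
  mulX (λ k → arrangementPoly m m k + S k) k
    ≡⟨ mulX-+ (arrangementPoly m m) S k ⟩
  mulX (arrangementPoly m m) k + mulX S k
    ≡⟨ cong (mulX (arrangementPoly m m) k +_) (mulX-sumBelow-arrangementPoly {m} ≤-refl k) ⟩
  mulX (arrangementPoly m m) k + m * arrangementPoly m m k
    ≡⟨ mulXplus≗mulX+· m (arrangementPoly m m) k ⟨
  mulXplus m (arrangementPoly m m) k
    ≡⟨ mulXplus-cong m (arrangementPoly-diag m) k ⟩
  risingℕ (suc m) k
    ≡⟨ arrangementPoly-diag (suc m) k ⟨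
  arrangementPoly (suc m) (suc m) k ∎
  where
  open ≡-Reasoning
  S = λ k → sumBelow (λ j → arrangementPoly m j k) m

-- The case r = suc m (hence c = 0) is split off: there arrangementPoly m r is a junk value
-- (m ∸ r truncates to 0) and the first summand vanishes.
arrangementPoly-recurrence : ∀ {m r c} → c + r ≡ suc m →
  (λ k → c * arrangementPoly m r k + mulX (λ k′ → sumBelow (λ j → arrangementPoly m j k′) r) k)
    ≗ arrangementPoly (suc m) r
arrangementPoly-recurrence {m} {r} {c} c+r≡1+m k with r ≤? m
... | yes r≤m = begin
  c * arrangementPoly m r k + mulX S k
    ≡⟨ cong (c * arrangementPoly m r k +_) (mulX-sumBelow-arrangementPoly r≤m k) ⟩
  c * arrangementPoly m r k + r * arrangementPoly m r k
    ≡⟨ *-distribʳ-+ (arrangementPoly m r k) c r ⟨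
  (c + r) * arrangementPoly m r k
    ≡⟨ cong (_* arrangementPoly m r k) c+r≡1+m ⟩
  suc m * arrangementPoly m r k
    ≡⟨ arrangementPoly-suc r≤m k ⟨
  arrangementPoly (suc m) r k ∎
  where
  open ≡-Reasoning
  S = λ k → sumBelow (λ j → arrangementPoly m j k) r
... | no r≰m with ≤-antisym (subst (r ≤_) c+r≡1+m (m≤n+m r c)) (≰⇒> r≰m)
... | refl with +-cancelʳ-≡ r c 0 c+r≡1+m
... | refl = mulX-sumBelow-arrangementPoly-top m k

-- The entries already read are kept most recent first, as in mmpAux.
isRecord : List ℕ → ℕ → Bool
isRecord pre a = not (any (a <ᵇ_) pre)

isFresh : List ℕ → ℕ → Bool
isFresh pre a = not (any (a ≡ᵇ_) pre)

isFreshRecord : List ℕ → ℕ → Bool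
isFreshRecord pre a = isFresh pre a ∧ isRecord pre a

isFreshNonRecord : List ℕ → ℕ → Bool
isFreshNonRecord pre a = isFresh pre a ∧ not (isRecord pre a)

records : List ℕ → List ℕ → ℕ
records pre []      = 0
records pre (a ∷ w) = boolToℕ (isRecord pre a) + records (a ∷ pre) w

injectiveAfter : List ℕ → List ℕ → Bool
injectiveAfter pre w = allDistinct w ∧ all (isFresh pre) w

hasRecords : List ℕ → ℕ → List ℕ → Bool
hasRecords pre k w = injectiveAfter pre w ∧ (records pre w ≡ᵇ k)

word : ∀ {n m} → Vec (Fin n) m → List ℕ
word w = map toℕ (toList w)

recordDistribution : ℕ → List ℕ → ℕ → ℕ → ℕ
recordDistribution n pre m k = count (hasRecords pre k ∘ word) (allWords n m)

freshCount : ℕ → List ℕ → ℕ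
freshCount n pre = count (isFresh pre) (range 0 n)

freshRecordCount : ℕ → List ℕ → ℕ
freshRecordCount n pre = count (isFreshRecord pre) (range 0 n)

recordsAbove : ℕ → List ℕ → ℕ → ℕ
recordsAbove n pre a = count (λ b → (a <ᵇ b) ∧ isFreshRecord pre b) (range 0 n)

all-isFresh-cons : ∀ a pre w → all (isFresh (a ∷ pre)) w ≡ not (any (a ≡ᵇ_) w) ∧ all (isFresh pre) w
all-isFresh-cons a pre []      = refl
all-isFresh-cons a pre (b ∷ w) rewrite all-isFresh-cons a pre w | ≡ᵇ-sym b a with a ≡ᵇ b
... | true  = refl
... | false = x∙yz≈y∙xz (isFresh pre b) (not (any (a ≡ᵇ_) w)) (all (isFresh pre) w)

injectiveAfter-cons : ∀ pre a w → injectiveAfter pre (a ∷ w) ≡ isFresh pre a ∧ injectiveAfter (a ∷ pre) w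
injectiveAfter-cons pre a w rewrite all-isFresh-cons a pre w with isFresh pre a
... | false = ∧-zeroʳ _
... | true  = xy∙z≈y∙xz (not (any (a ≡ᵇ_) w)) (allDistinct w) (all (isFresh pre) w)

recordDistribution-firstLetter : ∀ n pre m k a →
  count (λ w → hasRecords pre k (a ∷ word w)) (allWords n m)
    ≡ boolToℕ (isFreshNonRecord pre a) * recordDistribution n (a ∷ pre) m k
      + boolToℕ (isFreshRecord pre a) * mulX (recordDistribution n (a ∷ pre) m) k
recordDistribution-firstLetter n pre m k a =
  trans (sumOver-cong (λ w → cong (λ b → boolToℕ (b ∧ (records pre (a ∷ word w) ≡ᵇ k)))
                                (injectiveAfter-cons pre a (word w))) ws)
        (byCases (isFresh pre a) (isRecord pre a) k)
  where
  ws = allWords n m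
  D = recordDistribution n (a ∷ pre) m
  byCases : ∀ fresh isRec k →
    count (λ w → (fresh ∧ injectiveAfter (a ∷ pre) (word w))
                 ∧ ((boolToℕ isRec + records (a ∷ pre) (word w)) ≡ᵇ k)) ws
      ≡ boolToℕ (fresh ∧ not isRec) * D k + boolToℕ (fresh ∧ isRec) * mulX D k
  byCases false isRec  k       = sumOver-zero (λ _ → refl) ws
  byCases true  false  k       = sym (trans (+-identityʳ _) (+-identityʳ (D k)))
  byCases true  true   zero    = sumOver-zero (λ w → cong boolToℕ (∧-zeroʳ _)) ws
  byCases true  true   (suc k) = sym (+-identityʳ (D k))

recordDistribution-suc : ∀ n pre m k →
  recordDistribution n pre (suc m) k
    ≡ sumOver (λ a → boolToℕ (isFreshNonRecord pre a) * recordDistribution n (a ∷ pre) m k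
                     + boolToℕ (isFreshRecord pre a) * mulX (recordDistribution n (a ∷ pre) m) k)
              (range 0 n)
recordDistribution-suc n pre m k =
  trans (sumOver-concatMap _ (λ a → map (a ∷ᵥ_) (allWords n m)) (allFin n))
        (sumOver-tabulate n (λ i → i) _ _ 0 λ i →
          trans (sumOver-map _ (i ∷ᵥ_) (allWords n m))
                (recordDistribution-firstLetter n pre m k (toℕ i)))

nonRecord<record : ∀ pre {a b} → isRecord pre a ≡ false → isRecord pre b ≡ true → a < b
nonRecord<record []        ()
nonRecord<record (p ∷ pre) {a} {b} a≮rec b-rec with a <ᵇ p in a<ᵇp | b <ᵇ p in b<ᵇp
... | true  | false = <-≤-trans (<ᵇ≡true⇒< a p a<ᵇp) (<ᵇ≡false⇒≥ b p b<ᵇp)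
... | false | false = nonRecord<record pre a≮rec b-rec
... | _     | true  with () ← b-rec

freshRecordCount-cons : ∀ n pre a → freshRecordCount n (a ∷ pre) ≡ recordsAbove n pre a
freshRecordCount-cons n pre a = sumOver-cong (cong boolToℕ ∘ pointwise) (range 0 n)
  where
  pointwise : ∀ b → isFreshRecord (a ∷ pre) b ≡ (a <ᵇ b) ∧ isFreshRecord pre b
  pointwise b with <-cmp b a
  ... | tri< b<a _ _ rewrite <⇒<ᵇ≡true b<a | ≤⇒<ᵇ≡false (<⇒≤ b<a) = ∧-zeroʳ _
  ... | tri≈ _ refl _ rewrite ≡ᵇ-refl b | ≤⇒<ᵇ≡false (≤-refl {b}) = refl
  ... | tri> _ _ a<b rewrite ≢⇒≡ᵇ≡false (>⇒≢ a<b) | ≤⇒<ᵇ≡false (<⇒≤ a<b) | <⇒<ᵇ≡true a<b = refl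

freshRecordCount-nonRecord : ∀ n pre a → isRecord pre a ≡ false →
  freshRecordCount n (a ∷ pre) ≡ freshRecordCount n pre
freshRecordCount-nonRecord n pre a a≮rec =
  trans (freshRecordCount-cons n pre a) (sumOver-cong (cong boolToℕ ∘ pointwise) (range 0 n))
  where
  pointwise : ∀ b → (a <ᵇ b) ∧ isFreshRecord pre b ≡ isFreshRecord pre b
  pointwise b with isRecord pre b in b-rec
  ... | true  rewrite <⇒<ᵇ≡true (nonRecord<record pre a≮rec b-rec) = refl
  ... | false rewrite ∧-zeroʳ (isFresh pre b) = ∧-zeroʳ (a <ᵇ b)

freshCount-cons : ∀ n pre a → a < n → isFresh pre a ≡ true →
  freshCount n pre ≡ suc (freshCount n (a ∷ pre))
freshCount-cons n pre a a<n a-fresh = begin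
  freshCount n pre
    ≡⟨ count-split (isFresh pre) (_≡ᵇ a) (range 0 n) ⟨
  count (λ b → isFresh pre b ∧ not (b ≡ᵇ a)) (range 0 n) + count (λ b → isFresh pre b ∧ (b ≡ᵇ a)) (range 0 n)
    ≡⟨ cong₂ _+_ (sumOver-cong (cong boolToℕ ∘ others) (range 0 n))
                 (trans (sumOver-cong (cong boolToℕ ∘ itself) (range 0 n)) (count-range-≡ᵇ a 0 n z≤n a<n)) ⟩
  freshCount n (a ∷ pre) + 1
    ≡⟨ +-comm (freshCount n (a ∷ pre)) 1 ⟩
  suc (freshCount n (a ∷ pre)) ∎
  where
  open ≡-Reasoning
  others : ∀ b → isFresh pre b ∧ not (b ≡ᵇ a) ≡ isFresh (a ∷ pre) b
  others b with b ≡ᵇ a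
  ... | true  = ∧-zeroʳ (isFresh pre b)
  ... | false = ∧-identityʳ (isFresh pre b)
  itself : ∀ b → isFresh pre b ∧ (b ≡ᵇ a) ≡ (b ≡ᵇ a)
  itself b with b ≡ᵇ a in b≡ᵇa
  ... | true  = trans (∧-identityʳ (isFresh pre b)) (trans (cong (isFresh pre) (≡ᵇ≡true⇒≡ b a b≡ᵇa)) a-fresh)
  ... | false = ∧-zeroʳ (isFresh pre b)

sumOver-mulX-countAbove : ∀ (U : ℕ → Bool) (P : ℕ → ℕ → ℕ) n k →
  sumOver (λ a → boolToℕ (U a) * mulX (P (count (λ b → (a <ᵇ b) ∧ U b) (range 0 n))) k) (range 0 n)
    ≡ mulX (λ k′ → sumBelow (λ j → P j k′) (count U (range 0 n))) k
sumOver-mulX-countAbove U P n zero    = sumOver-zero (λ a → *-zeroʳ (boolToℕ (U a))) (range 0 n)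
sumOver-mulX-countAbove U P n (suc k) = sumOver-countAbove U (λ j → P j k) 0 n

arrangementPoly-byFirstLetter : ∀ n pre m → freshCount n pre ≡ suc m → ∀ k →
  sumOver (λ a → boolToℕ (isFreshNonRecord pre a) * arrangementPoly m (freshRecordCount n pre) k
                 + boolToℕ (isFreshRecord pre a) * mulX (arrangementPoly m (recordsAbove n pre a)) k)
          (range 0 n)
    ≡ arrangementPoly (suc m) (freshRecordCount n pre) k
arrangementPoly-byFirstLetter n pre m mFresh k = begin
  sumOver (λ a → boolToℕ (isFreshNonRecord pre a) * arrangementPoly m r k + G a) (range 0 n)
    ≡⟨ sumOver-+ _ G (range 0 n) ⟩
  sumOver (λ a → boolToℕ (isFreshNonRecord pre a) * arrangementPoly m r k) (range 0 n) + sumOver G (range 0 n)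
    ≡⟨ cong₂ _+_ (sumOver-*ʳ (boolToℕ ∘ isFreshNonRecord pre) (arrangementPoly m r k) (range 0 n))
                 (sumOver-mulX-countAbove (isFreshRecord pre) (arrangementPoly m) n k) ⟩
  count (isFreshNonRecord pre) (range 0 n) * arrangementPoly m r k
    + mulX (λ k′ → sumBelow (λ j → arrangementPoly m j k′) r) k
    ≡⟨ arrangementPoly-recurrence {m} {r}
         (trans (count-split (isFresh pre) (isRecord pre) (range 0 n)) mFresh) k ⟩
  arrangementPoly (suc m) r k ∎
  where
  open ≡-Reasoning
  r = freshRecordCount n pre
  G = λ a → boolToℕ (isFreshRecord pre a) * mulX (arrangementPoly m (recordsAbove n pre a)) k

recordDistribution-closedForm : ∀ n m pre → freshCount n pre ≡ m →
  recordDistribution n pre m ≗ arrangementPoly m (freshRecordCount n pre)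
recordDistribution-closedForm n zero    pre noneFresh = base
  where
  noFreshRecord : freshRecordCount n pre ≡ 0
  noFreshRecord = n≤0⇒n≡0 (subst (freshRecordCount n pre ≤_)
    (trans (count-split (isFresh pre) (isRecord pre) (range 0 n)) noneFresh) (m≤n+m _ _))
  base : recordDistribution n pre zero ≗ arrangementPoly zero (freshRecordCount n pre)
  base zero    rewrite noFreshRecord = refl
  base (suc k) rewrite noFreshRecord = refl
recordDistribution-closedForm n (suc m) pre mFresh k =
  trans (recordDistribution-suc n pre m k)
        (trans (sumOver-range-cong 0 n (λ a _ → byInduction a))
               (arrangementPoly-byFirstLetter n pre m mFresh k))
  where
  IH : ∀ a → a < n → isFresh pre a ≡ true →
       recordDistribution n (a ∷ pre) m ≗ arrangementPoly m (freshRecordCount n (a ∷ pre))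
  IH a a<n a-fresh = recordDistribution-closedForm n m (a ∷ pre)
    (suc-injective (trans (sym (freshCount-cons n pre a a<n a-fresh)) mFresh))
  byInduction : ∀ a → a < n →
    boolToℕ (isFreshNonRecord pre a) * recordDistribution n (a ∷ pre) m k
      + boolToℕ (isFreshRecord pre a) * mulX (recordDistribution n (a ∷ pre) m) k
    ≡ boolToℕ (isFreshNonRecord pre a) * arrangementPoly m (freshRecordCount n pre) k
      + boolToℕ (isFreshRecord pre a) * mulX (arrangementPoly m (recordsAbove n pre a)) k
  byInduction a a<n with isFresh pre a in a-fresh
  ... | false = refl
  ... | true with isRecord pre a in a-rec
  ...   | false = cong (λ d → d + 0 + 0)
    (trans (IH a a<n a-fresh k) (cong (λ j → arrangementPoly m j k) (freshRecordCount-nonRecord n pre a a-rec)))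
  ...   | true  = cong (_+ 0) (mulX-cong (λ k′ →
    trans (IH a a<n a-fresh k′) (cong (λ j → arrangementPoly m j k′) (freshRecordCount-cons n pre a))) k)

maximum⁺ : ℕ → List ℕ → ℕ
maximum⁺ a []      = a
maximum⁺ a (b ∷ w) = a ⊔ maximum⁺ b w

<ᵇ-⊔ : ∀ a x y → ((a <ᵇ x) ∨ (a <ᵇ y)) ≡ (a <ᵇ (x ⊔ y))
<ᵇ-⊔ a x y with ≤-total x y
... | inj₁ x≤y rewrite m≤n⇒m⊔n≡n x≤y with a <ᵇ x in a<ᵇx
...   | true  = sym (<⇒<ᵇ≡true (<-≤-trans (<ᵇ≡true⇒< a x a<ᵇx) x≤y))
...   | false = refl
<ᵇ-⊔ a x y | inj₂ y≤x rewrite m≥n⇒m⊔n≡m y≤x with a <ᵇ y in a<ᵇy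
...   | true  = trans (∨-zeroʳ (a <ᵇ x)) (sym (<⇒<ᵇ≡true (<-≤-trans (<ᵇ≡true⇒< a y a<ᵇy) y≤x)))
...   | false = ∨-identityʳ (a <ᵇ x)

any-<ᵇ-maximum⁺ : ∀ a b w → any (λ c → a <ᵇ c) (b ∷ w) ≡ (a <ᵇ maximum⁺ b w)
any-<ᵇ-maximum⁺ a b []      = ∨-identityʳ (a <ᵇ b)
any-<ᵇ-maximum⁺ a b (c ∷ w) = trans (cong ((a <ᵇ b) ∨_) (any-<ᵇ-maximum⁺ a c w)) (<ᵇ-⊔ a b (maximum⁺ c w))

maximum⁺-∈ : ∀ b w → any (maximum⁺ b w ≡ᵇ_) (b ∷ w) ≡ true
maximum⁺-∈ b []      = cong (_∨ false) (≡ᵇ-refl b)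
maximum⁺-∈ b (c ∷ w) with ⊔-sel b (maximum⁺ c w)
... | inj₁ b⊔M≡b rewrite b⊔M≡b = cong (_∨ any (b ≡ᵇ_) (c ∷ w)) (≡ᵇ-refl b)
... | inj₂ b⊔M≡M rewrite b⊔M≡M = trans (cong ((maximum⁺ c w ≡ᵇ b) ∨_) (maximum⁺-∈ c w)) (∨-zeroʳ _)

isRecord-cons-≤ : ∀ pre {a b} → a ≤ b → isRecord (a ∷ pre) b ≡ isRecord pre b
isRecord-cons-≤ pre a≤b rewrite ≤⇒<ᵇ≡false a≤b = refl

isRecord-cons-> : ∀ pre {a b} → b < a → isRecord (a ∷ pre) b ≡ false
isRecord-cons-> pre b<a rewrite <⇒<ᵇ≡true b<a = refl

-- The entries counted by mmpAux are the records other than the overall maximum.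
mmpAux+maximumRecord : ∀ pre a w → allDistinct (a ∷ w) ≡ true →
  mmpAux pre (a ∷ w) + boolToℕ (isRecord pre (maximum⁺ a w)) ≡ records pre (a ∷ w)
mmpAux+maximumRecord pre a []      _        = +-comm 0 (boolToℕ (isRecord pre a))
mmpAux+maximumRecord pre a (b ∷ w) distinct
  with not (any (a ≡ᵇ_) (b ∷ w)) in a∉w | allDistinct (b ∷ w) in distinct-w
... | false | _    with () ← distinct
... | true  | false with () ← distinct
... | true  | true  rewrite any-<ᵇ-maximum⁺ a b w with <-cmp a (maximum⁺ b w)
...   | tri< a<M _ _ rewrite <⇒<ᵇ≡true a<M | m≤n⇒m⊔n≡n (<⇒≤ a<M) =
  trans (+-assoc (boolToℕ (isRecord pre a)) _ _) (cong (boolToℕ (isRecord pre a) +_)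
    (subst (λ e → mmpAux (a ∷ pre) (b ∷ w) + boolToℕ e ≡ records (a ∷ pre) (b ∷ w))
           (isRecord-cons-≤ pre (<⇒≤ a<M)) (mmpAux+maximumRecord (a ∷ pre) b w distinct-w)))
...   | tri≈ _ a≡M _ = contradiction (trans (sym (cong not a∈w)) a∉w) λ ()
  where
  a∈w : any (a ≡ᵇ_) (b ∷ w) ≡ true
  a∈w = subst (λ x → any (x ≡ᵇ_) (b ∷ w) ≡ true) (sym a≡M) (maximum⁺-∈ b w)
...   | tri> _ _ M<a rewrite ≤⇒<ᵇ≡false (<⇒≤ M<a) | m≥n⇒m⊔n≡m (<⇒≤ M<a) =
  trans (+-comm (mmpAux (a ∷ pre) (b ∷ w)) (boolToℕ (isRecord pre a))) (cong (boolToℕ (isRecord pre a) +_)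
    (trans (sym (+-identityʳ _))
           (subst (λ e → mmpAux (a ∷ pre) (b ∷ w) + boolToℕ e ≡ records (a ∷ pre) (b ∷ w))
                  (isRecord-cons-> pre M<a) (mmpAux+maximumRecord (a ∷ pre) b w distinct-w))))

suc-mmp≡records : ∀ {n} (σ : Vec (Fin (suc n)) (suc n)) → isPerm σ ≡ true →
                  suc (mmp σ) ≡ records [] (values σ)
suc-mmp≡records (a ∷ᵥ w) distinct =
  trans (+-comm 1 (mmp (a ∷ᵥ w))) (mmpAux+maximumRecord [] (toℕ a) (word w) distinct)

all-isFresh-[] : ∀ w → all (isFresh []) w ≡ true
all-isFresh-[] []      = refl
all-isFresh-[] (a ∷ w) = all-isFresh-[] w

Rcoeff≡recordDistribution : ∀ n k → Rcoeff (suc n) k ≡ recordDistribution (suc n) [] (suc n) (suc k)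
Rcoeff≡recordDistribution n k = begin
  Rcoeff (suc n) k
    ≡⟨ length-filter _ (perms (suc n)) ⟩
  count (λ σ → mmp σ ≡ᵇ k) (perms (suc n))
    ≡⟨ count-filter _ _ (allWords (suc n) (suc n)) ⟩
  count (λ σ → does (Bool._≟_ (isPerm σ) true) ∧ (mmp σ ≡ᵇ k)) (allWords (suc n) (suc n))
    ≡⟨ sumOver-cong (cong boolToℕ ∘ pointwise) (allWords (suc n) (suc n)) ⟩
  recordDistribution (suc n) [] (suc n) (suc k) ∎
  where
  open ≡-Reasoning
  pointwise : ∀ σ → does (Bool._≟_ (isPerm σ) true) ∧ (mmp σ ≡ᵇ k) ≡ hasRecords [] (suc k) (values σ)
  pointwise σ rewrite all-isFresh-[] (values σ) | ∧-identityʳ (isPerm σ) with isPerm σ in perm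
  ... | false = refl
  ... | true  = cong (_≡ᵇ suc k) (suc-mmp≡records σ perm)

risingℕ-constantTerm : ∀ m → risingℕ (suc m) 0 ≡ 0
risingℕ-constantTerm zero    = refl
risingℕ-constantTerm (suc m) = trans (cong (suc m *_) (risingℕ-constantTerm m)) (*-zeroʳ (suc m))

risingℕ-suc≡prodP : ∀ m k → risingℕ (suc m) (suc k) ≡ prodP m k
risingℕ-suc≡prodP zero    k       = +-identityʳ (one k)
risingℕ-suc≡prodP (suc m) zero    =
  cong₂ (λ a b → a + suc m * b) (risingℕ-constantTerm m) (risingℕ-suc≡prodP m 0)
risingℕ-suc≡prodP (suc m) (suc k) =
  cong₂ (λ a b → a + suc m * b) (risingℕ-suc≡prodP m k) (risingℕ-suc≡prodP m (suc k))

Rcoeff≡prodP : ∀ n → 1 ≤ n → ∀ k → Rcoeff n k ≡ prodP (n ∸ 1) k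
Rcoeff≡prodP (suc n) _ k = begin
  Rcoeff (suc n) k
    ≡⟨ Rcoeff≡recordDistribution n k ⟩
  recordDistribution (suc n) [] (suc n) (suc k)
    ≡⟨ recordDistribution-closedForm (suc n) (suc n) [] allFresh (suc k) ⟩
  arrangementPoly (suc n) (freshRecordCount (suc n) []) (suc k)
    ≡⟨ cong (λ r → arrangementPoly (suc n) r (suc k)) allFresh ⟩
  arrangementPoly (suc n) (suc n) (suc k)
    ≡⟨ arrangementPoly-diag (suc n) (suc k) ⟩
  risingℕ (suc n) (suc k)
    ≡⟨ risingℕ-suc≡prodP n k ⟩
  prodP n k ∎
  where
  open ≡-Reasoning
  allFresh : count (λ _ → true) (range 0 (suc n)) ≡ suc n
  allFresh = count-range-true 0 (suc n)

-- Opened only here: the prefix +_ of ℤ would make the sections (n +_) above ambiguous.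
open import Data.Integer using (+_)
import Data.Integer as ℤ
import Data.Integer.Properties as ℤ
open import Data.Product using (_×_; _,_)

rising≡risingℕ : ∀ n k → rising n k ≡ + risingℕ n k
rising≡risingℕ zero    zero    = refl
rising≡risingℕ zero    (suc k) = refl
rising≡risingℕ (suc m) zero    =
  trans (cong (+ m ℤ.*_) (rising≡risingℕ m zero)) (sym (ℤ.pos-* m (risingℕ m zero)))
rising≡risingℕ (suc m) (suc k) = begin
  rising m k ℤ.+ + m ℤ.* rising m (suc k)
    ≡⟨ cong₂ (λ a b → a ℤ.+ + m ℤ.* b) (rising≡risingℕ m k) (rising≡risingℕ m (suc k)) ⟩
  + risingℕ m k ℤ.+ + m ℤ.* + risingℕ m (suc k)
    ≡⟨ cong (ℤ._+_ (+ risingℕ m k)) (ℤ.pos-* m (risingℕ m (suc k))) ⟨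
  + risingℕ m k ℤ.+ + (m * risingℕ m (suc k))
    ≡⟨ ℤ.pos-+ (risingℕ m k) (m * risingℕ m (suc k)) ⟨
  + risingℕ (suc m) (suc k) ∎
  where open ≡-Reasoning

binomSeries-constantTerm : ∀ n → (binomSeries ⊖ oneS) n zero ≡ + 0
binomSeries-constantTerm zero    = refl
binomSeries-constantTerm (suc m) =
  cong (ℤ._- + 0) (trans (rising≡risingℕ (suc m) zero) (cong +_ (risingℕ-constantTerm m)))

Rseries≡ : ∀ n k → Rseries n k ≡ (oneS ⊕ divX (binomSeries ⊖ oneS)) n k
Rseries≡ zero    zero    = refl
Rseries≡ zero    (suc k) = refl
Rseries≡ (suc m) k = sym (begin
  + 0 ℤ.+ (rising (suc m) (suc k) ℤ.- + 0)  ≡⟨ ℤ.+-identityˡ _ ⟩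
  rising (suc m) (suc k) ℤ.- + 0            ≡⟨ ℤ.+-identityʳ _ ⟩
  rising (suc m) (suc k)                    ≡⟨ rising≡risingℕ (suc m) (suc k) ⟩
  + risingℕ (suc m) (suc k)                 ≡⟨ cong +_ (risingℕ-suc≡prodP m k) ⟩
  + prodP m k                               ≡⟨ cong +_ (Rcoeff≡prodP (suc m) (s≤s z≤n) k) ⟨
  + Rcoeff (suc m) k                        ∎)
  where open ≡-Reasoning

mainTheorem5 : ((n : ℕ) → 1 ≤ n → (k : ℕ) → Rcoeff n k ≡ prodP (n ∸ 1) k)
               × ((n : ℕ) → (binomSeries ⊖ oneS) n zero ≡ + 0)
               × ((n k : ℕ) → Rseries n k ≡ (oneS ⊕ divX (binomSeries ⊖ oneS)) n k)
mainTheorem5 = Rcoeff≡prodP , binomSeries-constantTerm , Rseries≡
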